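{- Let $\Gamma=(V,E)$ be a finite, simple, connected graph of valency $2r$ for some prime $r$, and let $G\le\mathrm{Aut}\,\Gamma$ be transitive on $V$ and $E$ but not transitive on the set of $2$-arcs of $\Gamma$. Suppose $G$ is intransitive on the arc set of $\Gamma$, and let $N\ne1$ be a normal subgroup of $G$; let $\alpha\in V$. Then one of the following holds: (1) $N$ is semiregular on $V$; (2) $r=\max\pi(N_\alpha)$, and either (i) $N$ is transitive on both $V$ and $E$, or (ii) $G/K\cong\mathbb{Z}_l$, where $l\ge2$ is the number of $N$-orbits on $V$ and $K$ is the kernel of the action of $G$ on the set of $N$-orbits.
   Context: A $2$-arc is a triple $(\alpha,\beta,\gamma)$ of vertices with $\alpha\ne\gamma$ and $\{\alpha,\beta\},\{\beta,\gamma\}\in E$; arcs are ordered pairs $(\alpha,\beta)$ with $\{\alpha,\beta\}\in E$. $N_\alpha$ is the stabilizer of $\alpha$ in $N$, and $\pi(Y)$ is the set of prime divisors of $|Y|$. -}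

module Defs where

open import Data.Nat using (ℕ; zero; suc; _+_; _*_; _≤_)
open import Data.Nat.DivMod using (_mod_)
open import Data.Nat.Divisibility using (_∣_)
open import Data.Nat.Primality using (Prime)
open import Data.Bool using (Bool; T)
open import Data.Fin using (Fin; toℕ; _≟_)
open import Data.Vec using (Vec; lookup; tabulate; allFin)
open import Data.List using (List; length; filter; filterᵇ)
import Data.Fin.Properties
open import Data.List.Membership.Propositional using (_∈_)
open import Data.List.Relation.Unary.Unique.Propositional using (Unique)
open import Data.Product using (Σ; ∃; _×_; _,_)
open import Data.Sum using (_⊎_)
open import Relation.Nullary using (¬_)
open import Relation.Binary.PropositionalEquality using (_≡_)

-- Graphs on the vertex set V = Fin n, given by a Boolean adjacency
-- function; {u,v} ∈ E  iff  T (adj u v).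

Adj : ℕ → Set
Adj n = Fin n → Fin n → Bool

SimpleGraph : ∀ {n} → Adj n → Set
SimpleGraph {n} adj = (∀ u v → adj u v ≡ adj v u) × (∀ u → ¬ T (adj u u))

data Path {n} (adj : Adj n) : Fin n → Fin n → Set where
  here : ∀ {u} → Path adj u u
  step : ∀ {u w v} → T (adj u w) → Path adj w v → Path adj u v

Connected : ∀ {n} → Adj n → Set
Connected adj = ∀ u v → Path adj u v

degree : ∀ {n} → Adj n → Fin n → ℕ
degree {n} adj v = length (filterᵇ (adj v) (Data.Vec.toList (allFin n)))
  where import Data.Vec

-- Permutations of Fin n as lookup tables; (g ∘ₚ h) x = g (h x).

Perm : ℕ → Set
Perm n = Vec (Fin n) n

app : ∀ {n} → Perm n → Fin n → Fin n
app = lookup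

idP : ∀ {n} → Perm n
idP {n} = allFin n

_∘ₚ_ : ∀ {n} → Perm n → Perm n → Perm n
g ∘ₚ h = tabulate (λ x → app g (app h x))

IsPerm : ∀ {n} → Perm n → Set
IsPerm σ = ∀ x y → app σ x ≡ app σ y → x ≡ y

record PermGroup (n : ℕ) : Set where
  field
    elems  : List (Perm n)
    unique : Unique elems
    perms  : ∀ {g} → g ∈ elems → IsPerm g
    id∈    : idP ∈ elems
    closed : ∀ {g h} → g ∈ elems → h ∈ elems → (g ∘ₚ h) ∈ elems
open PermGroup public

order : ∀ {n} → PermGroup n → ℕ
order G = length (elems G)

IsAut : ∀ {n} → Adj n → Perm n → Set
IsAut adj σ = IsPerm σ × (∀ u v → adj (app σ u) (app σ v) ≡ adj u v)

AutGroup : ∀ {n} → Adj n → PermGroup n → Set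
AutGroup adj G = ∀ {g} → g ∈ elems G → IsAut adj g

VertexTransitive : ∀ {n} → PermGroup n → Set
VertexTransitive G = ∀ u v → Σ _ λ g → g ∈ elems G × app g u ≡ v

EdgeTransitive : ∀ {n} → Adj n → PermGroup n → Set
EdgeTransitive adj G = ∀ u v x y → T (adj u v) → T (adj x y) →
  Σ _ λ g → g ∈ elems G ×
    ((app g u ≡ x × app g v ≡ y) ⊎ (app g u ≡ y × app g v ≡ x))

ArcTransitive : ∀ {n} → Adj n → PermGroup n → Set
ArcTransitive adj G = ∀ u v x y → T (adj u v) → T (adj x y) →
  Σ _ λ g → g ∈ elems G × app g u ≡ x × app g v ≡ y

Is2Arc : ∀ {n} → Adj n → Fin n → Fin n → Fin n → Set
Is2Arc adj a b c = ¬ a ≡ c × T (adj a b) × T (adj b c)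

TwoArcTransitive : ∀ {n} → Adj n → PermGroup n → Set
TwoArcTransitive adj G = ∀ a b c x y z → Is2Arc adj a b c → Is2Arc adj x y z →
  Σ _ λ g → g ∈ elems G × app g a ≡ x × app g b ≡ y × app g c ≡ z

NormalSub : ∀ {n} → PermGroup n → PermGroup n → Set
NormalSub N G = (∀ {h} → h ∈ elems N → h ∈ elems G) ×
  (∀ {g h} → g ∈ elems G → h ∈ elems N →
     Σ _ λ h' → h' ∈ elems N × (g ∘ₚ h) ≡ (h' ∘ₚ g))

Nontrivial : ∀ {n} → PermGroup n → Set
Nontrivial N = Σ _ λ h → h ∈ elems N × ¬ h ≡ idP

Semiregular : ∀ {n} → PermGroup n → Set
Semiregular N = ∀ {h} → h ∈ elems N → ∀ v → app h v ≡ v → h ≡ idP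

stabOrder : ∀ {n} → PermGroup n → Fin n → ℕ
stabOrder N α = length (filter (λ h → app h α ≟ α) (elems N))

IsMaxPrimeDivisor : ℕ → ℕ → Set
IsMaxPrimeDivisor r m = Prime r × r ∣ m × (∀ p → Prime p → p ∣ m → p ≤ r)

addMod : ∀ {l} → Fin l → Fin l → Fin l
addMod {suc k} a b = (toℕ a + toℕ b) mod suc k

-- o : V → Fin l labels the N-orbits bijectively (so l = number of N-orbits)
OrbitLabelling : ∀ {n l} → PermGroup n → (Fin n → Fin l) → Set
OrbitLabelling {n} {l} N o =
  (∀ (i : Fin l) → Σ (Fin n) λ v → o v ≡ i) ×
  (∀ u v → o u ≡ o v → Σ _ λ h → h ∈ elems N × app h u ≡ v) ×
  (∀ u v h → h ∈ elems N → app h u ≡ v → o u ≡ o v)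

InKernel : ∀ {n l} → (Fin n → Fin l) → Perm n → Set
InKernel o g = ∀ v → o (app g v) ≡ o v

-- G/K ≅ ℤ_l, with l ≥ 2 the number of N-orbits and K the kernel of the
-- action on the N-orbits; expressed as a surjective homomorphism
-- φ : G → ℤ_l with kernel exactly K.
QuotientCyclic : ∀ {n} → PermGroup n → PermGroup n → Set
QuotientCyclic {n} G N =
  Σ ℕ λ l → Σ (Fin n → Fin l) λ o → OrbitLabelling N o × 2 ≤ l ×
  Σ (Perm n → Fin l) λ φ →
    (∀ {g h} → g ∈ elems G → h ∈ elems G → φ (g ∘ₚ h) ≡ addMod (φ g) (φ h)) ×
    (∀ (i : Fin l) → Σ _ λ g → g ∈ elems G × φ g ≡ i) ×
    (∀ {g} → g ∈ elems G → (toℕ (φ g) ≡ 0 → InKernel o g) × (InKernel o g → toℕ (φ g) ≡ 0))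

module Submission where

open import Defs
open import Data.Nat as ℕ using (ℕ; zero; suc; _+_; _*_; _∸_; _≤_; _<_; z≤n; s≤s; >-nonZero⁻¹)
import Data.Nat.Properties as ℕP
open import Data.Nat.DivMod using (_mod_; _%_; _/_; m≡m%n+[m/n]*n; m%n<n; m<n⇒m%n≡m)
open import Data.Nat.Divisibility using (_∣_; ∣m∣n⇒∣m+n; ∣-refl; _∣0; ∣1⇒≡1; ∣⇒≤; m∣m*n)
open import Data.Nat.Primality using (Prime; ¬prime[1]; euclidsLemma; prime⇒irreducible; prime⇒nonZero)
open import Data.Bool using (T; T?)
open import Data.Fin as F using (Fin; _≟_; toℕ)
import Data.Fin.Properties as FP
import Data.Vec as V
open import Data.Vec.Properties using (lookup∘tabulate; tabulate∘lookup; tabulate-cong; lookup-allFin; ≡-dec)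
open import Data.List as L using (List; []; _∷_; length; filter; cartesianProduct)
open import Data.List.Properties using (filter-notAll; length-++; length-map; filter-++; length-tabulate)
open import Data.List.Membership.Propositional using (_∈_; find; lose)
open import Data.List.Membership.Propositional.Properties using (∈-filter⁺; ∈-filter⁻; ∈-allFin; ∈-length; ∈-cartesianProduct⁺; ∈-cartesianProduct⁻)
open import Data.List.Relation.Unary.Any as Any using (Any; here; there; any?)
open import Data.List.Relation.Unary.Any.Properties using (lookup-index)
open import Data.List.Relation.Unary.All as All using (All; []; _∷_)
open import Data.List.Relation.Unary.All.Properties.Core using (¬All⇒Any¬)
open import Data.List.Relation.Unary.AllPairs using ([]; _∷_)
open import Data.List.Relation.Unary.Unique.Propositional using (Unique)
open import Data.List.Relation.Unary.Unique.Propositional.Properties using (Unique[x∷xs]⇒x∉xs; filter⁺; allFin⁺; cartesianProduct⁺)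
open import Data.Product using (Σ; _×_; _,_; proj₁; proj₂)
import Data.Product.Properties as ×P
open import Data.Sum using (_⊎_; inj₁; inj₂) renaming (swap to ⊎-swap)
open import Data.Empty using (⊥; ⊥-elim)
open import Relation.Nullary using (¬_; Dec; yes; no; ¬?)
open import Relation.Nullary.Decidable using (_→-dec_; _×-dec_)
open import Relation.Unary using (Pred; Decidable)
open import Relation.Binary.Definitions using (DecidableEquality; tri<; tri≈; tri>)
open import Relation.Binary.PropositionalEquality
import Relation.Binary.Reasoning.Base.Single
open import Agda.Primitive using (lzero)

-- The G-orbit of one arc orients each edge exactly one way, and double
-- counting gives every vertex r out- and r in-neighbours
-- (half-arc-orientation).  The rest uses only such a RegularOrientation:
--  * fixer-primes: a subgroup of G fixing a vertex has all prime divisors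
--    ≤ r (walk to a moved vertex, orbit–stabiliser, induction on order);
--  * LocalAction: if k ∈ N fixes u and moves an out-neighbour of u, then by
--    normality the N_x-orbits on the r out-neighbours of x have one size,
--    ≠ 1 and dividing r, so N_x is transitive on them and r ∣ |N_x|;
--  * SuccessorOnOrbits, CyclicQuotient: then "out-neighbour" is a
--    bijection of the N-orbits, which by connectivity form one cycle of
--    length l; G translates it, giving the two alternatives l = 1, l ≥ 2.
-- If N is not semiregular, connectivity yields the situation of
-- LocalAction, possibly after reversing the orientation.

module _ {A B : Set} where

  injection-length : DecidableEquality B → (xs : List A) (ys : List B) → Unique xs →
    (f : A → B) → (∀ {x} → x ∈ xs → f x ∈ ys) →
    (∀ {x y} → x ∈ xs → y ∈ xs → f x ≡ f y → x ≡ y) → length xs ≤ length ys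
  injection-length _≟B_ [] ys _ f _ _ = z≤n
  injection-length _≟B_ (x ∷ xs) ys (x∉xs ∷ xs!) f maps inj =
    ℕP.≤-trans (s≤s (injection-length _≟B_ xs ys' xs! f maps' inj')) ys'<ys
    where
    ≢fx? : Decidable (λ y → ¬ y ≡ f x)
    ≢fx? y = ¬? (y ≟B f x)
    ys' : List B
    ys' = filter ≢fx? ys
    ys'<ys : suc (length ys') ≤ length ys
    ys'<ys = filter-notAll ≢fx? ys (Any.map (λ e ne → ne (sym e)) (maps (here refl)))
    maps' : ∀ {y} → y ∈ xs → f y ∈ ys'
    maps' {y} y∈ = ∈-filter⁺ ≢fx? (maps (there y∈)) λ e →
      Unique[x∷xs]⇒x∉xs (x∉xs ∷ xs!) (subst (_∈ xs) (inj (there y∈) (here refl) e) y∈)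
    inj' : ∀ {a b} → a ∈ xs → b ∈ xs → f a ≡ f b → a ≡ b
    inj' a∈ b∈ = inj (there a∈) (there b∈)

module _ {A : Set} where

  covers : DecidableEquality A → (xs ys : List A) → Unique xs → (∀ {x} → x ∈ xs → x ∈ ys) →
    length ys ≤ length xs → ∀ {y} → y ∈ ys → y ∈ xs
  covers _≟A_ xs ys xs! sub ys≤xs {y} y∈ys with any? (y ≟A_) xs
  ... | yes y∈xs = y∈xs
  ... | no y∉xs = ⊥-elim (ℕP.<⇒≱ (ℕP.≤-<-trans xs≤ys' ys'<ys) ys≤xs)
    where
    ≢y? : Decidable (λ z → ¬ z ≡ y)
    ≢y? z = ¬? (z ≟A y)
    ys'<ys : length (filter ≢y? ys) < length ys
    ys'<ys = filter-notAll ≢y? ys (Any.map (λ e ne → ne (sym e)) y∈ys)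
    xs≤ys' : length xs ≤ length (filter ≢y? ys)
    xs≤ys' = injection-length _≟A_ xs (filter ≢y? ys) xs! (λ z → z)
      (λ {x} x∈ → ∈-filter⁺ ≢y? (sub x∈) λ e → y∉xs (subst (_∈ xs) e x∈))
      (λ _ _ e → e)

  two-members : DecidableEquality A → {x y : A} {xs : List A} → x ∈ xs → y ∈ xs → ¬ x ≡ y →
    2 ≤ length xs
  two-members _≟A_ {x} {y} x∈ y∈ x≢y =
    injection-length _≟A_ (x ∷ y ∷ []) _ ((x≢y ∷ []) ∷ [] ∷ []) (λ z → z) members (λ _ _ e → e)
    where
    members : ∀ {z} → z ∈ x ∷ y ∷ [] → z ∈ _
    members (here refl) = x∈
    members (there (here refl)) = y∈

module _ {A B : Set} where

  length-cartesianProduct : (xs : List A) (ys : List B) →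
    length (cartesianProduct xs ys) ≡ length xs * length ys
  length-cartesianProduct [] ys = refl
  length-cartesianProduct (x ∷ xs) ys =
    trans (length-++ (L.map (x ,_) ys)) (cong₂ _+_ (length-map _ ys) (length-cartesianProduct xs ys))

  count-pairs : {Q : A → B → Set} (Q? : ∀ a b → Dec (Q a b)) (xs : List A) (ys : List B) (c : ℕ) →
    (∀ {x} → x ∈ xs → length (filter (Q? x) ys) ≡ c) →
    length (filter (λ p → Q? (proj₁ p) (proj₂ p)) (cartesianProduct xs ys)) ≡ length xs * c
  count-pairs Q? [] ys c rows = refl
  count-pairs {Q} Q? (x ∷ xs) ys c rows = begin
      length (filter Q?× (L.map (x ,_) ys L.++ cartesianProduct xs ys))
    ≡⟨ cong length (filter-++ Q?× (L.map (x ,_) ys) (cartesianProduct xs ys)) ⟩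
      length (filter Q?× (L.map (x ,_) ys) L.++ filter Q?× (cartesianProduct xs ys))
    ≡⟨ length-++ (filter Q?× (L.map (x ,_) ys)) ⟩
      length (filter Q?× (L.map (x ,_) ys)) + length (filter Q?× (cartesianProduct xs ys))
    ≡⟨ cong₂ _+_ (trans (row ys) (rows (here refl))) (count-pairs Q? xs ys c (λ m → rows (there m))) ⟩
      c + length xs * c
    ∎
    where
    open ≡-Reasoning
    Q?× : ∀ p → Dec (Q (proj₁ p) (proj₂ p))
    Q?× p = Q? (proj₁ p) (proj₂ p)
    row : ∀ zs → length (filter Q?× (L.map (x ,_) zs)) ≡ length (filter (Q? x) zs)
    row [] = refl
    row (z ∷ zs) with Q? x z
    ... | yes _ = cong suc (row zs)
    ... | no _ = row zs

module _ {A : Set} {P : Pred A lzero} (P? : Decidable P) where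

  length-filter-split : (xs : List A) →
    length (filter P? xs) + length (filter (λ x → ¬? (P? x)) xs) ≡ length xs
  length-filter-split [] = refl
  length-filter-split (x ∷ xs) with P? x
  ... | yes _ = cong suc (length-filter-split xs)
  ... | no _ = trans (ℕP.+-suc _ _) (cong suc (length-filter-split xs))

  filter-witness : (xs : List A) → 0 < length (filter P? xs) → Any P xs
  filter-witness [] ()
  filter-witness (x ∷ xs) nonempty with P? x
  ... | yes p = here p
  ... | no _ = there (filter-witness xs nonempty)

  filter-absorb : {Q : Pred A lzero} (Q? : Decidable Q) (xs : List A) →
    (∀ {x} → x ∈ xs → P x → Q x) → filter P? (filter Q? xs) ≡ filter P? xs
  filter-absorb Q? [] _ = refl
  filter-absorb Q? (x ∷ xs) P⊆Q with Q? x
  ... | yes _ with P? x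
  ...   | yes _ = cong (x ∷_) (filter-absorb Q? xs (λ m → P⊆Q (there m)))
  ...   | no _ = filter-absorb Q? xs (λ m → P⊆Q (there m))
  filter-absorb Q? (x ∷ xs) P⊆Q | no ¬q with P? x
  ...   | yes p = ⊥-elim (¬q (P⊆Q (here refl) p))
  ...   | no _ = filter-absorb Q? xs (λ m → P⊆Q (there m))

  length-filter-cong : {Q : Pred A lzero} (Q? : Decidable Q) (xs : List A) →
    (∀ {x} → x ∈ xs → (P x → Q x) × (Q x → P x)) → length (filter P? xs) ≡ length (filter Q? xs)
  length-filter-cong Q? [] _ = refl
  length-filter-cong Q? (x ∷ xs) P⇔Q with P? x | Q? x
  ... | yes _ | yes _ = cong suc (length-filter-cong Q? xs (λ m → P⇔Q (there m)))
  ... | yes p | no ¬q = ⊥-elim (¬q (proj₁ (P⇔Q (here refl)) p))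
  ... | no ¬p | yes q = ⊥-elim (¬p (proj₂ (P⇔Q (here refl)) q))
  ... | no _ | no _ = length-filter-cong Q? xs (λ m → P⇔Q (there m))

-- If, for a decidable equivalence relation R, every x ∈ xs has exactly s
-- R-relatives in xs, then s divides |xs|: remove the class of the head
-- and recurse on the rest (with fuel bounding the length).
module _ {A : Set} {R : A → A → Set} (R? : ∀ x y → Dec (R x y))
  (R-refl : ∀ x → R x x) (R-sym : ∀ {x y} → R x y → R y x)
  (R-trans : ∀ {x y z} → R x y → R y z → R x z) where

  equal-classes-divide : (xs : List A) (s : ℕ) →
    (∀ {x} → x ∈ xs → length (filter (R? x) xs) ≡ s) → s ∣ length xs
  equal-classes-divide xs = go (length xs) xs ℕP.≤-refl
    where
    go : (k : ℕ) (xs : List A) → length xs ≤ k → (s : ℕ) →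
      (∀ {x} → x ∈ xs → length (filter (R? x) xs) ≡ s) → s ∣ length xs
    go _ [] _ s _ = s ∣0
    go zero (x ∷ xs) () s _
    go (suc k) (x ∷ xs) (s≤s bound) s sizes =
      subst (s ∣_) (length-filter-split (R? x) (x ∷ xs)) (∣m∣n⇒∣m+n class-x rest)
      where
      ≁x? : ∀ z → Dec (¬ R x z)
      ≁x? z = ¬? (R? x z)
      others : List A
      others = filter ≁x? (x ∷ xs)
      class-x : s ∣ length (filter (R? x) (x ∷ xs))
      class-x = subst (s ∣_) (sym (sizes (here refl))) ∣-refl
      shorter : length others < length (x ∷ xs)
      shorter = filter-notAll ≁x? (x ∷ xs) (here λ ¬r → ¬r (R-refl x))
      sizes' : ∀ {y} → y ∈ others → length (filter (R? y) others) ≡ s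
      sizes' {y} y∈ = trans
        (cong length (filter-absorb (R? y) ≁x? (x ∷ xs)
          λ _ ryz rxz → proj₂ (∈-filter⁻ ≁x? y∈) (R-trans rxz (R-sym ryz))))
        (sizes (proj₁ (∈-filter⁻ ≁x? y∈)))
      rest : s ∣ length others
      rest = go k others (ℕP.≤-trans (ℕP.≤-pred shorter) bound) s sizes'

least : {P : ℕ → Set} → (∀ m → Dec (P m)) → ∀ d → P d → Σ ℕ λ k → P k × (∀ j → j < k → ¬ P j)
least {P} P? d pd with search (suc d)
  where
  search : ∀ m → (∀ j → j < m → ¬ P j) ⊎ (Σ ℕ λ k → P k × (∀ j → j < k → ¬ P j))
  search zero = inj₁ λ _ ()
  search (suc m) with search m
  ... | inj₂ found = inj₂ found
  ... | inj₁ none with P? m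
  ...   | yes pm = inj₂ (m , pm , none)
  ...   | no ¬pm = inj₁ λ j j<1+m → below-or-at (ℕP.m<1+n⇒m<n∨m≡n j<1+m)
    where
    below-or-at : ∀ {j} → j < m ⊎ j ≡ m → ¬ P j
    below-or-at (inj₁ j<m) = none _ j<m
    below-or-at (inj₂ refl) = ¬pm
... | inj₂ found = found
... | inj₁ none = ⊥-elim (none d (ℕP.n<1+n d) pd)

module _ {n : ℕ} where

  vertices : List (Fin n)
  vertices = L.allFin n

  vertices-unique : Unique vertices
  vertices-unique = allFin⁺ n

  app-∘ : (g h : Perm n) (x : Fin n) → app (g ∘ₚ h) x ≡ app g (app h x)
  app-∘ g h x = lookup∘tabulate _ x

  app-id : (x : Fin n) → app (idP {n}) x ≡ x
  app-id x = lookup-allFin x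

  perm-ext : {g h : Perm n} → (∀ x → app g x ≡ app h x) → g ≡ h
  perm-ext {g} {h} e = trans (sym (tabulate∘lookup g)) (trans (tabulate-cong e) (tabulate∘lookup h))

  _≟P_ : DecidableEquality (Perm n)
  _≟P_ = ≡-dec _≟_

  ∘-assoc : (f g h : Perm n) → (f ∘ₚ g) ∘ₚ h ≡ f ∘ₚ (g ∘ₚ h)
  ∘-assoc f g h = perm-ext λ x → begin
    app ((f ∘ₚ g) ∘ₚ h) x  ≡⟨ app-∘ (f ∘ₚ g) h x ⟩
    app (f ∘ₚ g) (app h x) ≡⟨ app-∘ f g (app h x) ⟩
    app f (app g (app h x)) ≡⟨ cong (app f) (app-∘ g h x) ⟨
    app f (app (g ∘ₚ h) x) ≡⟨ app-∘ f (g ∘ₚ h) x ⟨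
    app (f ∘ₚ (g ∘ₚ h)) x  ∎
    where open ≡-Reasoning

  ∘-idˡ : (g : Perm n) → idP ∘ₚ g ≡ g
  ∘-idˡ g = perm-ext λ x → trans (app-∘ idP g x) (app-id _)

  ∘-idʳ : (g : Perm n) → g ∘ₚ idP ≡ g
  ∘-idʳ g = perm-ext λ x → trans (app-∘ g idP x) (cong (app g) (app-id x))

  cancelˡ : {a b c : Perm n} → IsPerm a → a ∘ₚ b ≡ a ∘ₚ c → b ≡ c
  cancelˡ {a} {b} {c} a-perm e = perm-ext λ x →
    a-perm _ _ (trans (sym (app-∘ a b x)) (trans (cong (λ z → app z x) e) (app-∘ a c x)))

  pow : Perm n → ℕ → Perm n
  pow g zero = idP
  pow g (suc k) = g ∘ₚ pow g k

  pow-+ : (g : Perm n) (a b : ℕ) → pow g (a + b) ≡ pow g a ∘ₚ pow g b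
  pow-+ g zero b = sym (∘-idˡ _)
  pow-+ g (suc a) b = trans (cong (g ∘ₚ_) (pow-+ g a b)) (sym (∘-assoc g (pow g a) (pow g b)))

  pow-perm : {g : Perm n} → IsPerm g → (k : ℕ) → IsPerm (pow g k)
  pow-perm _ zero x y e = trans (sym (app-id x)) (trans e (app-id y))
  pow-perm {g} g-perm (suc k) x y e =
    pow-perm g-perm k x y (g-perm _ _ (trans (sym (app-∘ g (pow g k) x)) (trans e (app-∘ g (pow g k) y))))

  moved-point : (h : Perm n) → ¬ h ≡ idP → Σ (Fin n) λ w → ¬ app h w ≡ w
  moved-point h h≢id with All.all? (λ w → app h w ≟ w) vertices
  ... | yes fixes-all = ⊥-elim (h≢id (perm-ext λ x →
          trans (All.lookup fixes-all (∈-allFin x)) (sym (app-id x))))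
  ... | no ¬fixes-all with find (¬All⇒Any¬ (λ w → app h w ≟ w) vertices ¬fixes-all)
  ...   | w , _ , hw≢w = w , hw≢w

-- Inverses: in a finite permutation group every element has an inverse,
-- namely a suitable power of it (the powers must repeat by pigeonhole).

module _ {n : ℕ} (H : PermGroup n) where

  pow∈ : {g : Perm n} → g ∈ elems H → (k : ℕ) → pow g k ∈ elems H
  pow∈ g∈ zero = id∈ H
  pow∈ g∈ (suc k) = closed H g∈ (pow∈ g∈ k)

  record Inverse (g : Perm n) : Set where
    field
      inv : Perm n
      inv∈ : inv ∈ elems H
      inv∘g : inv ∘ₚ g ≡ idP

    inv-app : ∀ x → app inv (app g x) ≡ x
    inv-app x = trans (sym (app-∘ inv g x)) (trans (cong (λ q → app q x) inv∘g) (app-id x))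

  inverse : {g : Perm n} → g ∈ elems H → Inverse g
  inverse {g} g∈ with FP.pigeonhole (ℕP.n<1+n (length (elems H))) (λ k → Any.index (pow∈ g∈ (toℕ k)))
  ... | i , j , i<j , same-index = record
    { inv = pow g d ; inv∈ = pow∈ g∈ d ; inv∘g = trans commute (sym g∘gᵈ) }
    where
    gⁱ≡gʲ : pow g (toℕ i) ≡ pow g (toℕ j)
    gⁱ≡gʲ = trans (lookup-index (pow∈ g∈ (toℕ i)))
      (trans (cong (L.lookup (elems H)) same-index) (sym (lookup-index (pow∈ g∈ (toℕ j)))))
    d : ℕ
    d = toℕ j ∸ suc (toℕ i)
    j≡i+1+d : toℕ i + suc d ≡ toℕ j
    j≡i+1+d = trans (ℕP.+-suc (toℕ i) d) (ℕP.m+[n∸m]≡n {suc (toℕ i)} {toℕ j} i<j)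
    g∘gᵈ : idP ≡ g ∘ₚ pow g d
    g∘gᵈ = cancelˡ {a = pow g (toℕ i)} (pow-perm {g = g} (perms H g∈) (toℕ i)) (begin
      pow g (toℕ i) ∘ₚ idP               ≡⟨ ∘-idʳ _ ⟩
      pow g (toℕ i)                      ≡⟨ gⁱ≡gʲ ⟩
      pow g (toℕ j)                      ≡⟨ cong (pow g) j≡i+1+d ⟨
      pow g (toℕ i + suc d)              ≡⟨ pow-+ g (toℕ i) (suc d) ⟩
      pow g (toℕ i) ∘ₚ (g ∘ₚ pow g d)    ∎)
      where open ≡-Reasoning
    commute : pow g d ∘ₚ g ≡ g ∘ₚ pow g d
    commute = trans (cong (pow g d ∘ₚ_) (sym (∘-idʳ g)))
      (trans (sym (pow-+ g d 1)) (cong (pow g) (ℕP.+-comm d 1)))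

module _ {n : ℕ} where

  _⊑_ : PermGroup n → PermGroup n → Set
  H ⊑ G = ∀ {h} → h ∈ elems H → h ∈ elems G

  FixedBy : PermGroup n → Fin n → Set
  FixedBy H x = All (λ h → app h x ≡ x) (elems H)

  FixedBy? : (H : PermGroup n) (x : Fin n) → Dec (FixedBy H x)
  FixedBy? H x = All.all? (λ h → app h x ≟ x) (elems H)

  fixing-everything-trivial : (H : PermGroup n) → (∀ x → FixedBy H x) → order H ≡ 1
  fixing-everything-trivial H fixed = ℕP.≤-antisym
    (injection-length _≟P_ (elems H) (idP {n} ∷ []) (unique H) (λ _ → idP {n}) (λ _ → here refl)
      (λ h∈ h'∈ _ → trans (identity h∈) (sym (identity h'∈))))
    (∈-length (id∈ H))
    where
    identity : ∀ {h} → h ∈ elems H → h ≡ idP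
    identity h∈ = perm-ext λ x → trans (All.lookup (fixed x) h∈) (sym (app-id x))

  InOrbit : PermGroup n → Fin n → Fin n → Set
  InOrbit H x y = Any (λ h → app h x ≡ y) (elems H)

  InOrbit? : (H : PermGroup n) (x y : Fin n) → Dec (InOrbit H x y)
  InOrbit? H x y = any? (λ h → app h x ≟ y) (elems H)

  orbit : PermGroup n → Fin n → List (Fin n)
  orbit H x = filter (InOrbit? H x) vertices

  orbit-unique : (H : PermGroup n) (x : Fin n) → Unique (orbit H x)
  orbit-unique H x = filter⁺ (InOrbit? H x) vertices-unique

  in-orbit : (H : PermGroup n) {x : Fin n} {h : Perm n} → h ∈ elems H → InOrbit H x (app h x)
  in-orbit H h∈ = Any.map (λ e → cong (λ z → app z _) (sym e)) h∈

  orbit⁺ : (H : PermGroup n) {x y : Fin n} → InOrbit H x y → y ∈ orbit H x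
  orbit⁺ H {x} p = ∈-filter⁺ (InOrbit? H x) (∈-allFin _) p

  orbit⁻ : (H : PermGroup n) {x y : Fin n} → y ∈ orbit H x → InOrbit H x y
  orbit⁻ H {x} p = proj₂ (∈-filter⁻ (InOrbit? H x) {xs = vertices} p)

  module _ (H : PermGroup n) where

    orbit-refl : ∀ x → InOrbit H x x
    orbit-refl x = subst (InOrbit H x) (app-id x) (in-orbit H (id∈ H))

    orbit-sym : ∀ {x y} → InOrbit H x y → InOrbit H y x
    orbit-sym {x} p with find p
    ... | h , h∈ , refl = subst (InOrbit H (app h x)) (Inverse.inv-app I x) (in-orbit H (Inverse.inv∈ I))
      where I = inverse H h∈

    orbit-trans : ∀ {x y z} → InOrbit H x y → InOrbit H y z → InOrbit H x z
    orbit-trans {x} p q with find p | find q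
    ... | h , h∈ , refl | h' , h'∈ , refl = subst (InOrbit H x) (app-∘ h' h x) (in-orbit H (closed H h'∈ h∈))

  stab : PermGroup n → Fin n → PermGroup n
  stab H x = record
    { elems = filter fixes? (elems H)
    ; unique = filter⁺ fixes? (unique H)
    ; perms = λ p → perms H (proj₁ (∈-filter⁻ fixes? {xs = elems H} p))
    ; id∈ = ∈-filter⁺ fixes? (id∈ H) (app-id x)
    ; closed = λ {g} {h} p q →
        let (g∈ , gx) = ∈-filter⁻ fixes? {xs = elems H} p
            (h∈ , hx) = ∈-filter⁻ fixes? {xs = elems H} q
        in ∈-filter⁺ fixes? (closed H g∈ h∈) (trans (app-∘ g h x) (trans (cong (app g) hx) gx))
    }
    where
    fixes? : ∀ h → Dec (app h x ≡ x)
    fixes? h = app h x ≟ x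

  module _ (H : PermGroup n) (x : Fin n) where

    stab⊆ : stab H x ⊑ H
    stab⊆ p = proj₁ (∈-filter⁻ (λ h → app h x ≟ x) {xs = elems H} p)

    stab-fixes : {h : Perm n} → h ∈ elems (stab H x) → app h x ≡ x
    stab-fixes p = proj₂ (∈-filter⁻ (λ h → app h x ≟ x) {xs = elems H} p)

    stab⁺ : {h : Perm n} → h ∈ elems H → app h x ≡ x → h ∈ elems (stab H x)
    stab⁺ p q = ∈-filter⁺ (λ h → app h x ≟ x) p q

  -- Orbit–stabiliser theorem |H| = |x^H| · |H_x|, via the bijection
  -- h ↦ (h x, t(h x)⁻¹ h) onto x^H × H_x, where t y ∈ H maps x to y.
  module _ (H : PermGroup n) (x : Fin n) where
    private
      t : Fin n → Perm n
      t y with InOrbit? H x y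
      ... | yes p = proj₁ (find p)
      ... | no _ = idP

      t∈ : ∀ y → t y ∈ elems H
      t∈ y with InOrbit? H x y
      ... | yes p = proj₁ (proj₂ (find p))
      ... | no _ = id∈ H

      t-maps : ∀ {y} → InOrbit H x y → app (t y) x ≡ y
      t-maps {y} q with InOrbit? H x y
      ... | yes p = proj₂ (proj₂ (find p))
      ... | no ¬p = ⊥-elim (¬p q)

      t⁻¹ : (y : Fin n) → Inverse H (t y)
      t⁻¹ y = inverse H (t∈ y)

      pairs : List (Fin n × Perm n)
      pairs = cartesianProduct (orbit H x) (elems (stab H x))

      split : Perm n → Fin n × Perm n
      split h = app h x , Inverse.inv (t⁻¹ (app h x)) ∘ₚ h

      split∈ : ∀ {h} → h ∈ elems H → split h ∈ pairs
      split∈ {h} h∈ = ∈-cartesianProduct⁺ (orbit⁺ H (in-orbit H h∈))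
        (stab⁺ H x (closed H inv∈ h∈) (begin
          app (inv ∘ₚ h) x               ≡⟨ app-∘ inv h x ⟩
          app inv (app h x)              ≡⟨ cong (app inv) (t-maps (in-orbit H h∈)) ⟨
          app inv (app (t (app h x)) x)  ≡⟨ inv-app x ⟩
          x                              ∎))
        where
        open ≡-Reasoning
        open Inverse (t⁻¹ (app h x))

      split-inj : ∀ {h h'} → h ∈ elems H → h' ∈ elems H → split h ≡ split h' → h ≡ h'
      split-inj {h} {h'} _ _ e = cancelˡ {a = Inverse.inv (t⁻¹ (app h x))} (perms H (Inverse.inv∈ (t⁻¹ (app h x))))
        (trans (cong proj₂ e) (cong (λ z → Inverse.inv (t⁻¹ z) ∘ₚ h') (sym (cong proj₁ e))))

      join : Fin n × Perm n → Perm n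
      join (y , k) = t y ∘ₚ k

      join∈ : ∀ {p} → p ∈ pairs → join p ∈ elems H
      join∈ {y , k} m = closed H (t∈ y) (stab⊆ H x (proj₂ (∈-cartesianProduct⁻ (orbit H x) _ m)))

      join-maps : ∀ {p} → p ∈ pairs → app (join p) x ≡ proj₁ p
      join-maps {y , k} m = trans (app-∘ (t y) k x)
        (trans (cong (app (t y)) (stab-fixes H x k∈)) (t-maps (orbit⁻ H y∈)))
        where
        y∈ : y ∈ orbit H x
        y∈ = proj₁ (∈-cartesianProduct⁻ (orbit H x) (elems (stab H x)) m)
        k∈ : k ∈ elems (stab H x)
        k∈ = proj₂ (∈-cartesianProduct⁻ (orbit H x) (elems (stab H x)) m)

      join-inj : ∀ {p q} → p ∈ pairs → q ∈ pairs → join p ≡ join q → p ≡ q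
      join-inj {y , k} {y' , k'} p∈ q∈ e =
        cong₂ _,_ y≡y' (cancelˡ {a = t y'} (perms H (t∈ y')) (trans (cong (λ z → t z ∘ₚ k) (sym y≡y')) e))
        where
        y≡y' : y ≡ y'
        y≡y' = trans (sym (join-maps p∈)) (trans (cong (λ z → app z x) e) (join-maps q∈))

    orbit-stabiliser : order H ≡ length (orbit H x) * order (stab H x)
    orbit-stabiliser = ℕP.≤-antisym
      (subst (order H ≤_) (length-cartesianProduct (orbit H x) (elems (stab H x)))
        (injection-length (×P.≡-dec _≟_ _≟P_) (elems H) pairs (unique H) split split∈ split-inj))
      (subst (_≤ order H) (length-cartesianProduct (orbit H x) (elems (stab H x)))
        (injection-length _≟P_ pairs (elems H)
          (cartesianProduct⁺ (orbit-unique H x) (unique (stab H x))) join join∈ join-inj))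

  module _ (H : PermGroup n) {x : Fin n} {h : Perm n} (h∈ : h ∈ elems H) (h-moves : ¬ app h x ≡ x) where

    moved-orbit : 2 ≤ length (orbit H x)
    moved-orbit = two-members _≟_ (orbit⁺ H (orbit-refl H x)) (orbit⁺ H (in-orbit H h∈)) (λ e → h-moves (sym e))

    moved-stab-smaller : order (stab H x) < order H
    moved-stab-smaller = begin-strict
      order (stab H x)                        <⟨ s<2s (∈-length (id∈ (stab H x))) ⟩
      2 * order (stab H x)                    ≤⟨ ℕP.*-monoˡ-≤ (order (stab H x)) moved-orbit ⟩
      length (orbit H x) * order (stab H x)   ≡⟨ orbit-stabiliser H x ⟨
      order H                                 ∎
      where
      open ℕP.≤-Reasoning
      s<2s : ∀ {s} → 0 < s → s < 2 * s
      s<2s {s} 0<s = subst (s <_) (cong (s +_) (sym (ℕP.+-identityʳ s))) (ℕP.m<m+n s 0<s)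

module _ {n : ℕ} {N G : PermGroup n} (normal : NormalSub N G) where

  conjugate : ∀ {g h} → g ∈ elems G → h ∈ elems N →
    Σ (Perm n) λ h' → h' ∈ elems N × (∀ z → app h' (app g z) ≡ app g (app h z))
  conjugate {g} {h} g∈ h∈ with proj₂ normal g∈ h∈
  ... | h' , h'∈ , gh≡h'g = h' , h'∈ , λ z →
    trans (sym (app-∘ h' g z)) (trans (cong (λ q → app q z) (sym gh≡h'g)) (app-∘ g h z))

  conjugate-stab : ∀ {g h x} → g ∈ elems G → h ∈ elems (stab N x) →
    Σ (Perm n) λ h' → h' ∈ elems (stab N (app g x)) × (∀ z → app h' (app g z) ≡ app g (app h z))
  conjugate-stab {g} {h} {x} g∈ h∈ with conjugate g∈ (stab⊆ N x h∈)
  ... | h' , h'∈ , h'g≡gh = h' , stab⁺ N (app g x) h'∈ (trans (h'g≡gh x) (cong (app g) (stab-fixes N x h∈))) , h'g≡gh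

module _ {n : ℕ} where
  private
    regular-at? : ∀ (h : Perm n) v → Dec (app h v ≡ v → h ≡ idP)
    regular-at? h v = (app h v ≟ v) →-dec (h ≟P idP)

    regular? : ∀ h → Dec (All (λ v → app h v ≡ v → h ≡ idP) vertices)
    regular? h = All.all? (regular-at? h) vertices

  semiregular-or-fixer : (N : PermGroup n) →
    Semiregular N ⊎ Σ (Perm n) λ h → Σ (Fin n) λ v → h ∈ elems N × app h v ≡ v × ¬ h ≡ idP
  semiregular-or-fixer N with All.all? regular? (elems N)
  ... | yes semi = inj₁ λ h∈ v hv≡v → All.lookup (All.lookup semi h∈) (∈-allFin v) hv≡v
  ... | no ¬semi with find (¬All⇒Any¬ regular? (elems N) ¬semi)
  ...   | h , h∈ , ¬regular-h with find (¬All⇒Any¬ (regular-at? h) vertices ¬regular-h)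
  ...     | v , _ , ¬regular-hv with app h v ≟ v | h ≟P idP
  ...       | yes hv≡v | no h≢id = inj₂ (h , v , h∈ , hv≡v , h≢id)
  ...       | yes _ | yes h≡id = ⊥-elim (¬regular-hv λ _ → h≡id)
  ...       | no hv≢v | _ = ⊥-elim (¬regular-hv λ hv≡v → ⊥-elim (hv≢v hv≡v))

module _ {n : ℕ} (adj : Adj n) where

  neighbours : Fin n → List (Fin n)
  neighbours u = filter (λ v → T? (adj u v)) vertices

  -- The valency in Defs counts over the vector of all vertices.
  degree-neighbours : ∀ u → degree adj u ≡ length (neighbours u)
  degree-neighbours u = cong (λ xs → length (filter (λ v → T? (adj u v)) xs)) (toList-allFin n)
    where
    toList-tabulate : ∀ {A : Set} {m} (f : Fin m → A) → V.toList (V.tabulate f) ≡ L.tabulate f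
    toList-tabulate {m = zero} f = refl
    toList-tabulate {m = suc m} f = cong (f F.zero ∷_) (toList-tabulate (λ x → f (F.suc x)))
    toList-allFin : ∀ m → V.toList (V.allFin m) ≡ L.allFin m
    toList-allFin m = toList-tabulate (λ x → x)

  boundary-edge : {P : Fin n → Set} → (∀ x → Dec (P x)) → ∀ {x y} → Path adj x y → P x → ¬ P y →
    Σ (Fin n) λ a → Σ (Fin n) λ b → T (adj a b) × P a × ¬ P b
  boundary-edge P? here px ¬py = ⊥-elim (¬py px)
  boundary-edge P? (step {u} {w} e p) pu ¬py with P? w
  ... | yes pw = boundary-edge P? p pw ¬py
  ... | no ¬pw = u , w , e , pu , ¬pw

  fixed-moved-edge : Connected adj → ∀ {h v} → app h v ≡ v → ¬ h ≡ idP →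
    Σ (Fin n) λ a → Σ (Fin n) λ b → T (adj a b) × app h a ≡ a × ¬ app h b ≡ b
  fixed-moved-edge conn {h} {v} hv≡v h≢id with moved-point h h≢id
  ... | w , hw≢w = boundary-edge (λ x → app h x ≟ x) (conn v w) hv≡v hw≢w

record RegularOrientation {n : ℕ} (adj : Adj n) (G : PermGroup n) (r : ℕ) : Set₁ where
  field
    _⇒_ : Fin n → Fin n → Set
    _⇒?_ : ∀ u v → Dec (u ⇒ v)
    oriented : ∀ {u v} → T (adj u v) → u ⇒ v ⊎ v ⇒ u
    invariant : ∀ {g u v} → g ∈ elems G → u ⇒ v → app g u ⇒ app g v
    arc-transitive : ∀ {u v x y} → u ⇒ v → x ⇒ y →
      Σ (Perm n) λ g → g ∈ elems G × app g u ≡ x × app g v ≡ y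
    out-degree : ∀ u → length (filter (u ⇒?_) vertices) ≡ r
    in-degree : ∀ u → length (filter (_⇒? u) vertices) ≡ r

reverse : ∀ {n} {adj : Adj n} {G r} → RegularOrientation adj G r → RegularOrientation adj G r
reverse R = record
  { _⇒_ = λ u v → v ⇒ u
  ; _⇒?_ = λ u v → v ⇒? u
  ; oriented = λ e → ⊎-swap (oriented e)
  ; invariant = invariant
  ; arc-transitive = λ p q → let (g , g∈ , gv , gu) = arc-transitive p q in g , g∈ , gu , gv
  ; out-degree = in-degree
  ; in-degree = out-degree
  }
  where open RegularOrientation R

module _ {n : ℕ} {O : Fin n → Fin n → Set} (O? : ∀ u v → Dec (O u v)) where

  out-count : Fin n → ℕ
  out-count u = length (filter (O? u) vertices)

  in-count : Fin n → ℕ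
  in-count v = length (filter (λ u → O? u v) vertices)

  out-count-constant : (G : PermGroup n) → VertexTransitive G →
    (∀ {g u v} → g ∈ elems G → O u v → O (app g u) (app g v)) → ∀ u w → out-count u ≡ out-count w
  out-count-constant G vt invariant u w with vt u w
  ... | g , g∈ , refl = ℕP.≤-antisym (moved u g∈)
      (subst (λ z → out-count (app g u) ≤ out-count z) (Inverse.inv-app I u) (moved (app g u) (Inverse.inv∈ I)))
    where
    I : Inverse G g
    I = inverse G g∈
    moved : ∀ {h} u → h ∈ elems G → out-count u ≤ out-count (app h u)
    moved {h} u h∈ = injection-length _≟_ (filter (O? u) vertices) (filter (O? (app h u)) vertices)
      (filter⁺ (O? u) vertices-unique) (app h)
      (λ m → ∈-filter⁺ (O? (app h u)) (∈-allFin _) (invariant h∈ (proj₂ (∈-filter⁻ (O? u) {xs = vertices} m))))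
      (λ _ _ e → perms G h∈ _ _ e)

  double-count : Fin n → ∀ {c c'} → (∀ u → out-count u ≡ c) → (∀ v → in-count v ≡ c') → c ≡ c'
  double-count v₀ {c} {c'} outs ins = ℕP.*-cancelˡ-≡ c c' n {{nonzero v₀}} (begin
      n * c                         ≡⟨ count-related O? outs ⟨
      length (filter related pairs) ≡⟨ ℕP.≤-antisym (flip-≤ related flipped? (λ o → o))
                                                     (flip-≤ flipped? related (λ o → o)) ⟩
      length (filter flipped? pairs) ≡⟨ count-related (λ v u → O? u v) ins ⟩
      n * c'                        ∎)
    where
    open ≡-Reasoning
    nonzero : Fin n → ℕ.NonZero n
    nonzero F.zero = _
    nonzero (F.suc _) = _
    pairs : List (Fin n × Fin n)
    pairs = cartesianProduct vertices vertices
    related : ∀ p → Dec (O (proj₁ p) (proj₂ p))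
    related p = O? (proj₁ p) (proj₂ p)
    flipped? : ∀ p → Dec (O (proj₂ p) (proj₁ p))
    flipped? p = O? (proj₂ p) (proj₁ p)
    count-related : ∀ {Q : Fin n → Fin n → Set} (Q? : ∀ u v → Dec (Q u v)) {d : ℕ} →
      (∀ u → length (filter (Q? u) vertices) ≡ d) →
      length (filter (λ p → Q? (proj₁ p) (proj₂ p)) pairs) ≡ n * d
    count-related Q? {d} rows =
      trans (count-pairs Q? vertices vertices d (λ {u} _ → rows u)) (cong (_* d) (length-tabulate {n = n} (λ x → x)))
    swap : Fin n × Fin n → Fin n × Fin n
    swap (a , b) = b , a
    flip-≤ : {P Q : Fin n × Fin n → Set} (P? : ∀ p → Dec (P p)) (Q? : ∀ p → Dec (Q p)) →
      (∀ {p} → P p → Q (swap p)) → length (filter P? pairs) ≤ length (filter Q? pairs)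
    flip-≤ P? Q? P⇒Q = injection-length (×P.≡-dec _≟_ _≟_) (filter P? pairs) (filter Q? pairs)
      (filter⁺ P? (cartesianProduct⁺ vertices-unique vertices-unique)) swap
      (λ m → ∈-filter⁺ Q? (∈-cartesianProduct⁺ (∈-allFin _) (∈-allFin _)) (P⇒Q (proj₂ (∈-filter⁻ P? {xs = pairs} m))))
      (λ { {a , b} {c , d} _ _ refl → refl })

-- If G is transitive on the vertices and edges of Γ but not on its arcs,
-- then the G-orbit of a single arc (α, β) is a regular orientation of Γ,
-- of half the valency.
module _ {n : ℕ} (adj : Adj n) (r : ℕ) (r>0 : 0 < r) (simple : SimpleGraph adj)
  (valency : ∀ v → degree adj v ≡ 2 * r) (G : PermGroup n) (aut : AutGroup adj G)
  (vt : VertexTransitive G) (et : EdgeTransitive adj G) (¬at : ¬ ArcTransitive adj G)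
  (α : Fin n) where

  private
    has-neighbour : Any (λ v → T (adj α v)) vertices
    has-neighbour = filter-witness (λ v → T? (adj α v)) vertices (begin-strict
      0                              <⟨ ℕP.<-≤-trans r>0 (ℕP.m≤m+n r _) ⟩
      2 * r                          ≡⟨ valency α ⟨
      degree adj α                   ≡⟨ degree-neighbours adj α ⟩
      length (neighbours adj α)      ∎)
      where open ℕP.≤-Reasoning

    β : Fin n
    β = proj₁ (find has-neighbour)

    α—β : T (adj α β)
    α—β = proj₂ (proj₂ (find has-neighbour))

    _⇒_ : Fin n → Fin n → Set
    u ⇒ v = Any (λ g → app g α ≡ u × app g β ≡ v) (elems G)

    _⇒?_ : ∀ u v → Dec (u ⇒ v)
    u ⇒? v = any? (λ g → (app g α ≟ u) ×-dec (app g β ≟ v)) (elems G)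

    ⇒-adjacent : ∀ {u v} → u ⇒ v → T (adj u v)
    ⇒-adjacent o with find o
    ... | g , g∈ , refl , refl = subst T (sym (proj₂ (aut g∈) α β)) α—β

    invariant : ∀ {g u v} → g ∈ elems G → u ⇒ v → app g u ⇒ app g v
    invariant {g} g∈ o with find o
    ... | k , k∈ , refl , refl = lose (closed G g∈ k∈) (app-∘ g k α , app-∘ g k β)

    arc-transitive : ∀ {u v x y} → u ⇒ v → x ⇒ y → Σ (Perm n) λ g → g ∈ elems G × app g u ≡ x × app g v ≡ y
    arc-transitive o o' with find o | find o'
    ... | k , k∈ , refl , refl | k' , k'∈ , refl , refl =
      k' ∘ₚ Inverse.inv I , closed G k'∈ (Inverse.inv∈ I) , undo α , undo β
      where
      I : Inverse G k
      I = inverse G k∈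
      undo : ∀ z → app (k' ∘ₚ Inverse.inv I) (app k z) ≡ app k' z
      undo z = trans (app-∘ k' (Inverse.inv I) (app k z)) (cong (app k') (Inverse.inv-app I z))

    -- Edge-transitivity: every edge is an image of {α, β}, in one direction.
    oriented : ∀ {u v} → T (adj u v) → u ⇒ v ⊎ v ⇒ u
    oriented {u} {v} e with et α β u v α—β e
    ... | g , g∈ , inj₁ (gα , gβ) = inj₁ (lose g∈ (gα , gβ))
    ... | g , g∈ , inj₂ (gα , gβ) = inj₂ (lose g∈ (gα , gβ))

    -- No arc is oriented both ways, else G would be arc-transitive.
    antisymmetric : ∀ {u v} → u ⇒ v → v ⇒ u → ⊥
    antisymmetric {u} {v} uv vu = ¬at λ a b c d e e' → arc-transitive (every-arc e) (every-arc e')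
      where
      every-arc : ∀ {a b} → T (adj a b) → a ⇒ b
      every-arc e with oriented e
      ... | inj₁ ab = ab
      ... | inj₂ ba with arc-transitive uv ba
      ...   | g , g∈ , gu , gv = subst₂ _⇒_ gv gu (invariant g∈ vu)

    neighbours-split : ∀ u → length (neighbours adj u) ≡ out-count _⇒?_ u + in-count _⇒?_ u
    neighbours-split u = begin
        length (neighbours adj u)
      ≡⟨ length-filter-split (u ⇒?_) (neighbours adj u) ⟨
        length (filter (u ⇒?_) (neighbours adj u)) + length (filter (λ v → ¬? (u ⇒? v)) (neighbours adj u))
      ≡⟨ cong₂ _+_ (cong length (filter-absorb (u ⇒?_) adjacent? vertices (λ _ → ⇒-adjacent)))
                   (length-filter-cong (λ v → ¬? (u ⇒? v)) (_⇒? u) (neighbours adj u) in-iff-not-out) ⟩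
        out-count _⇒?_ u + length (filter (_⇒? u) (neighbours adj u))
      ≡⟨ cong (λ xs → out-count _⇒?_ u + length xs)
              (filter-absorb (_⇒? u) adjacent? vertices (λ _ vu → adj-sym (⇒-adjacent vu))) ⟩
        out-count _⇒?_ u + in-count _⇒?_ u
      ∎
      where
      open ≡-Reasoning
      adjacent? : ∀ v → Dec (T (adj u v))
      adjacent? v = T? (adj u v)
      adj-sym : ∀ {v} → T (adj v u) → T (adj u v)
      adj-sym {v} = subst T (proj₁ simple v u)
      in-iff-not-out : ∀ {v} → v ∈ neighbours adj u → (¬ u ⇒ v → v ⇒ u) × (v ⇒ u → ¬ u ⇒ v)
      in-iff-not-out m with oriented (proj₂ (∈-filter⁻ adjacent? {xs = vertices} m))
      ... | inj₁ uv = (λ ¬uv → ⊥-elim (¬uv uv)) , λ vu _ → antisymmetric uv vu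
      ... | inj₂ vu = (λ _ → vu) , λ vu' uv → antisymmetric uv vu'

    out-α : ∀ u → out-count _⇒?_ u ≡ out-count _⇒?_ α
    out-α u = out-count-constant _⇒?_ G vt invariant u α

    in-α : ∀ v → in-count _⇒?_ v ≡ in-count _⇒?_ α
    in-α v = out-count-constant (λ u v → v ⇒? u) G vt invariant v α

    -- Out- and in-degree agree, so each is half the valency 2r.
    out-degree-α : out-count _⇒?_ α ≡ r
    out-degree-α = ℕP.*-cancelˡ-≡ _ r 2 (begin
      2 * out-count _⇒?_ α                        ≡⟨ cong (out-count _⇒?_ α +_) (ℕP.+-identityʳ _) ⟩
      out-count _⇒?_ α + out-count _⇒?_ α         ≡⟨ cong (out-count _⇒?_ α +_) (double-count _⇒?_ α out-α in-α) ⟩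
      out-count _⇒?_ α + in-count _⇒?_ α          ≡⟨ neighbours-split α ⟨
      length (neighbours adj α)                   ≡⟨ degree-neighbours adj α ⟨
      degree adj α                                ≡⟨ valency α ⟩
      2 * r                                       ∎)
      where open ≡-Reasoning

  half-arc-orientation : RegularOrientation adj G r
  half-arc-orientation = record
    { _⇒_ = _⇒_
    ; _⇒?_ = _⇒?_
    ; oriented = oriented
    ; invariant = invariant
    ; arc-transitive = arc-transitive
    ; out-degree = λ u → trans (out-α u) out-degree-α
    ; in-degree = λ v → trans (in-α v) (trans (sym (double-count _⇒?_ α out-α in-α)) out-degree-α)
    }

module _ {n : ℕ} {adj : Adj n} {G : PermGroup n} {r : ℕ} where

  -- If H ≤ G fixes a and a ⇒ b, the H-orbit of b consists of
  -- out-neighbours of a, so it has at most r points.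
  out-neighbour-orbit : (R : RegularOrientation adj G r) (H : PermGroup n) → H ⊑ G →
    ∀ {a b} → RegularOrientation._⇒_ R a b → FixedBy H a → length (orbit H b) ≤ r
  out-neighbour-orbit R H H⊑G {a} {b} a⇒b fixed-a = subst (_ ≤_) (out-degree a)
    (injection-length _≟_ (orbit H b) (filter (a ⇒?_) vertices) (orbit-unique H b) (λ z → z)
      out-neighbour (λ _ _ e → e))
    where
    open RegularOrientation R
    out-neighbour : ∀ {y} → y ∈ orbit H b → y ∈ filter (a ⇒?_) vertices
    out-neighbour m with find (orbit⁻ H m)
    ... | h , h∈ , refl = ∈-filter⁺ (a ⇒?_) (∈-allFin _)
      (subst (λ z → z ⇒ app h b) (All.lookup fixed-a h∈) (invariant (H⊑G h∈) a⇒b))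

  neighbour-orbit : RegularOrientation adj G r → (H : PermGroup n) → H ⊑ G →
    ∀ {a b} → T (adj a b) → FixedBy H a → length (orbit H b) ≤ r
  neighbour-orbit R H H⊑G a—b with RegularOrientation.oriented R a—b
  ... | inj₁ a⇒b = out-neighbour-orbit R H H⊑G a⇒b
  ... | inj₂ b⇒a = out-neighbour-orbit (reverse R) H H⊑G b⇒a

  -- Walk from the fixed vertex to one moved by H; at the first
  -- edge (a, b) leaving the fixed points, |H| = |b^H| · |H_b| with
  -- |b^H| ≤ r, and H_b is a smaller subgroup fixing b.
  fixer-primes : RegularOrientation adj G r → Connected adj →
    (H : PermGroup n) → H ⊑ G → ∀ u₀ → FixedBy H u₀ → ∀ p → Prime p → p ∣ order H → p ≤ r
  fixer-primes R conn H = go (order H) H ℕP.≤-refl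
    where
    go : ∀ k H → order H ≤ k → H ⊑ G → ∀ u₀ → FixedBy H u₀ → ∀ p → Prime p → p ∣ order H → p ≤ r
    go zero H bound _ _ _ _ _ _ = ⊥-elim (ℕP.<⇒≱ (∈-length (id∈ H)) bound)
    go (suc k) H bound H⊑G u₀ fixed-u₀ p p-prime p∣H with All.all? (FixedBy? H) vertices
    ... | yes fixes-all = ⊥-elim (¬prime[1] (subst Prime (∣1⇒≡1 (subst (p ∣_) order≡1 p∣H)) p-prime))
      where
      order≡1 : order H ≡ 1
      order≡1 = fixing-everything-trivial H λ x → All.lookup fixes-all (∈-allFin x)
    ... | no ¬fixes-all with find (¬All⇒Any¬ (FixedBy? H) vertices ¬fixes-all)
    ...   | w , _ , ¬fixed-w with boundary-edge adj (FixedBy? H) (conn u₀ w) fixed-u₀ ¬fixed-w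
    ...     | a , b , a—b , fixed-a , ¬fixed-b with find (¬All⇒Any¬ (λ h → app h b ≟ b) (elems H) ¬fixed-b)
    ...       | h , h∈ , h-moves-b with euclidsLemma _ _ p-prime (subst (p ∣_) (orbit-stabiliser H b) p∣H)
    ...         | inj₁ p∣orbit = ℕP.≤-trans (∣⇒≤ ⦃ orbit-nonzero ⦄ p∣orbit) (neighbour-orbit R H H⊑G a—b fixed-a)
      where
      orbit-nonzero : ℕ.NonZero (length (orbit H b))
      orbit-nonzero = ℕ.>-nonZero (ℕP.<-trans (s≤s z≤n) (moved-orbit H h∈ h-moves-b))
    ...         | inj₂ p∣stab = go k (stab H b)
                    (ℕP.≤-pred (ℕP.≤-trans (moved-stab-smaller H h∈ h-moves-b) bound))
                    (λ m → H⊑G (stab⊆ H b m)) b (All.tabulate (stab-fixes H b)) p p-prime p∣stab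

-- The local action of a normal subgroup N ⊴ G on out-neighbourhoods,
-- for a regular orientation of prime valency r: as soon as one element
-- of N fixes a vertex u₁ and moves an out-neighbour v₁, every N_x is
-- transitive on the r out-neighbours of x.
module LocalAction {n : ℕ} {adj : Adj n} {G : PermGroup n} {r : ℕ}
  (R : RegularOrientation adj G r) (r-prime : Prime r) {N : PermGroup n} (normal : NormalSub N G)
  {u₁ v₁ : Fin n} {k : Perm n} (k∈N : k ∈ elems N) (k-fixes : app k u₁ ≡ u₁)
  (u₁⇒v₁ : RegularOrientation._⇒_ R u₁ v₁) (k-moves : ¬ app k v₁ ≡ v₁) where

  open RegularOrientation R

  private
    out-neighbours : Fin n → List (Fin n)
    out-neighbours x = filter (x ⇒?_) vertices

    N⊑G : N ⊑ G
    N⊑G = proj₁ normal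

    -- Conjugating k by some g with g(u₁, v₁) = (x, y) moves y inside N_x.
    stab-moves : ∀ {x y} → x ⇒ y → Σ (Perm n) λ k' → k' ∈ elems (stab N x) × ¬ app k' y ≡ y
    stab-moves x⇒y with arc-transitive u₁⇒v₁ x⇒y
    ... | g , g∈ , refl , refl with conjugate-stab {N = N} {G = G} normal g∈ (stab⁺ N u₁ k∈N k-fixes)
    ...   | k' , k'∈ , k'g≡gk = k' , k'∈ , λ e → k-moves (perms G g∈ _ _ (trans (sym (k'g≡gk v₁)) e))

    orbit-out : ∀ {x y z} → x ⇒ y → InOrbit (stab N x) y z → x ⇒ z
    orbit-out {x} {y} x⇒y p with find p
    ... | h , h∈ , refl = subst (λ w → w ⇒ app h y) (stab-fixes N x h∈) (invariant (N⊑G (stab⊆ N x h∈)) x⇒y)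

    -- Any g ∈ G_x carrying y to z carries the N_x-orbit of y into that of z.
    orbit-size-≤ : ∀ {x y z} → x ⇒ y → x ⇒ z → length (orbit (stab N x) y) ≤ length (orbit (stab N x) z)
    orbit-size-≤ {x} {y} {z} x⇒y x⇒z with arc-transitive x⇒y x⇒z
    ... | g , g∈ , gx≡x , gy≡z = injection-length _≟_ (orbit (stab N x) y) (orbit (stab N x) z)
          (orbit-unique (stab N x) y) (app g) image (λ _ _ e → perms G g∈ _ _ e)
      where
      image : ∀ {w} → w ∈ orbit (stab N x) y → app g w ∈ orbit (stab N x) z
      image m with find (orbit⁻ (stab N x) m)
      ... | h , h∈ , refl with conjugate-stab {N = N} {G = G} normal g∈ h∈
      ...   | h' , h'∈ , h'g≡gh = orbit⁺ (stab N x) (subst₂ (InOrbit (stab N x)) gy≡z (h'g≡gh y)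
                (subst (λ q → InOrbit (stab N q) (app g y) (app h' (app g y))) gx≡x (in-orbit (stab N (app g x)) h'∈)))

    orbit-size-same : ∀ {x y z} → x ⇒ y → x ⇒ z → length (orbit (stab N x) y) ≡ length (orbit (stab N x) z)
    orbit-size-same x⇒y x⇒z = ℕP.≤-antisym (orbit-size-≤ x⇒y x⇒z) (orbit-size-≤ x⇒z x⇒y)

    -- The N_x-orbits partition the r out-neighbours into classes of
    -- equal size, so that size divides r.
    orbit-size-divides : ∀ {x y} → x ⇒ y → length (orbit (stab N x) y) ∣ r
    orbit-size-divides {x} {y} x⇒y = subst (length (orbit (stab N x) y) ∣_) (out-degree x)
      (equal-classes-divide (InOrbit? Nx) (orbit-refl Nx) (orbit-sym Nx) (orbit-trans Nx)
        (out-neighbours x) _ class-size)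
      where
      Nx : PermGroup n
      Nx = stab N x
      class-size : ∀ {z} → z ∈ out-neighbours x → length (filter (InOrbit? Nx z) (out-neighbours x)) ≡ length (orbit Nx y)
      class-size {z} m = trans
        (cong length (filter-absorb (InOrbit? Nx z) (x ⇒?_) vertices (λ _ → orbit-out x⇒z)))
        (orbit-size-same x⇒z x⇒y)
        where
        x⇒z : x ⇒ z
        x⇒z = proj₂ (∈-filter⁻ (x ⇒?_) {xs = vertices} m)

  -- Being a divisor of the prime r other than 1, each orbit has size r.
  out-orbit-size : ∀ {x y} → x ⇒ y → length (orbit (stab N x) y) ≡ r
  out-orbit-size {x} x⇒y with prime⇒irreducible r-prime (orbit-size-divides x⇒y) | stab-moves x⇒y
  ... | inj₁ size≡1 | k' , k'∈ , k'-moves = ⊥-elim (ℕP.<⇒≱ (moved-orbit (stab N x) k'∈ k'-moves) (ℕP.≤-reflexive size≡1))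
  ... | inj₂ size≡r | _ = size≡r

  local-transitive : ∀ {x y z} → x ⇒ y → x ⇒ z → Σ (Perm n) λ h → h ∈ elems (stab N x) × app h y ≡ z
  local-transitive {x} {y} {z} x⇒y x⇒z = find (orbit⁻ (stab N x) z∈orbit)
    where
    z∈orbit : z ∈ orbit (stab N x) y
    z∈orbit = covers _≟_ (orbit (stab N x) y) (out-neighbours x) (orbit-unique (stab N x) y)
      (λ m → ∈-filter⁺ (x ⇒?_) (∈-allFin _) (orbit-out x⇒y (orbit⁻ (stab N x) m)))
      (ℕP.≤-reflexive (trans (out-degree x) (sym (out-orbit-size x⇒y))))
      (∈-filter⁺ (x ⇒?_) (∈-allFin _) x⇒z)

  r-divides-stab : ∀ {x y} → x ⇒ y → r ∣ stabOrder N x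
  r-divides-stab {x} {y} x⇒y = subst (r ∣_) (sym (begin
    order (stab N x)                                               ≡⟨ orbit-stabiliser (stab N x) y ⟩
    length (orbit (stab N x) y) * order (stab (stab N x) y)        ≡⟨ cong (_* _) (out-orbit-size x⇒y) ⟩
    r * order (stab (stab N x) y)                                  ∎)) (m∣m*n _)
    where open ≡-Reasoning

-- When N_x is transitive on the out-neighbours of every x, the relation
-- "out-neighbour" induces a well-defined, G-equivariant and injective
-- successor map on the set of N-orbits.
module SuccessorOnOrbits {n : ℕ} {adj : Adj n} {G : PermGroup n} {r : ℕ}
  (R : RegularOrientation adj G r) (r>0 : 0 < r) {N : PermGroup n} (normal : NormalSub N G)
  (local-transitive : ∀ {x y z} → RegularOrientation._⇒_ R x y → RegularOrientation._⇒_ R x z →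
    Σ (Perm n) λ h → h ∈ elems (stab N x) × app h y ≡ z) where

  open RegularOrientation R public

  _~_ : Fin n → Fin n → Set
  x ~ y = InOrbit N x y

  ~-refl : ∀ x → x ~ x
  ~-refl = orbit-refl N

  ~-sym : ∀ {x y} → x ~ y → y ~ x
  ~-sym = orbit-sym N

  ~-trans : ∀ {x y z} → x ~ y → y ~ z → x ~ z
  ~-trans = orbit-trans N

  module ~-Reasoning = Relation.Binary.Reasoning.Base.Single _~_ (λ {x} → ~-refl x) ~-trans

  N⊑G : N ⊑ G
  N⊑G = proj₁ normal

  ~-invariant : ∀ {g x y} → g ∈ elems G → x ~ y → app g x ~ app g y
  ~-invariant {g} {x} g∈ x~y with find x~y
  ... | h , h∈ , refl with conjugate {N = N} {G = G} normal g∈ h∈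
  ...   | h' , h'∈ , h'g≡gh = subst (app g x ~_) (h'g≡gh x) (in-orbit N h'∈)

  -- Chosen out- and in-neighbours of each vertex (there are r > 0 of
  -- each).
  abstract
    succ : Fin n → Fin n
    succ x = proj₁ (find (filter-witness (x ⇒?_) vertices (subst (0 <_) (sym (out-degree x)) r>0)))

    ⇒succ : ∀ x → x ⇒ succ x
    ⇒succ x = proj₂ (proj₂ (find (filter-witness (x ⇒?_) vertices (subst (0 <_) (sym (out-degree x)) r>0))))

    pred : Fin n → Fin n
    pred x = proj₁ (find (filter-witness (_⇒? x) vertices (subst (0 <_) (sym (in-degree x)) r>0)))

    pred⇒ : ∀ x → pred x ⇒ x
    pred⇒ x = proj₂ (proj₂ (find (filter-witness (_⇒? x) vertices (subst (0 <_) (sym (in-degree x)) r>0))))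

  -- All out-neighbours of x lie in one N-orbit, by local transitivity.
  succ-spec : ∀ {x y} → x ⇒ y → succ x ~ y
  succ-spec {x} x⇒y with local-transitive (⇒succ x) x⇒y
  ... | h , h∈ , h-maps = subst (succ x ~_) h-maps (in-orbit N (stab⊆ N x h∈))

  succ-cong : ∀ {x x'} → x ~ x' → succ x ~ succ x'
  succ-cong {x} x~x' with find x~x'
  ... | h , h∈ , refl = ~-trans (in-orbit N h∈) (~-sym (succ-spec (invariant (N⊑G h∈) (⇒succ x))))

  succ-pred : ∀ x → succ (pred x) ~ x
  succ-pred x = succ-spec (pred⇒ x)

  succ-equivariant : ∀ {g} x → g ∈ elems G → app g (succ x) ~ succ (app g x)
  succ-equivariant x g∈ = ~-sym (succ-spec (invariant g∈ (⇒succ x)))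

  succ^ : ℕ → Fin n → Fin n
  succ^ zero x = x
  succ^ (suc k) x = succ (succ^ k x)

  pred^ : ℕ → Fin n → Fin n
  pred^ zero x = x
  pred^ (suc k) x = pred (pred^ k x)

  succ^-+ : ∀ a b x → succ^ (a + b) x ≡ succ^ a (succ^ b x)
  succ^-+ zero b x = refl
  succ^-+ (suc a) b x = cong succ (succ^-+ a b x)

  succ^-suc : ∀ k x → succ^ (suc k) x ≡ succ^ k (succ x)
  succ^-suc k x = trans (cong (λ m → succ^ m x) (ℕP.+-comm 1 k)) (succ^-+ k 1 x)

  pred^-+ : ∀ a b x → pred^ (a + b) x ≡ pred^ a (pred^ b x)
  pred^-+ zero b x = refl
  pred^-+ (suc a) b x = cong pred (pred^-+ a b x)

  succ^-cong : ∀ k {x y} → x ~ y → succ^ k x ~ succ^ k y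
  succ^-cong zero x~y = x~y
  succ^-cong (suc k) x~y = succ-cong (succ^-cong k x~y)

  succ^-equivariant : ∀ {g} k x → g ∈ elems G → app g (succ^ k x) ~ succ^ k (app g x)
  succ^-equivariant zero x g∈ = ~-refl _
  succ^-equivariant (suc k) x g∈ = ~-trans (succ-equivariant (succ^ k x) g∈) (succ-cong (succ^-equivariant k x g∈))

  succ^-pred^ : ∀ k x → succ^ k (pred^ k x) ~ x
  succ^-pred^ zero x = ~-refl x
  succ^-pred^ (suc k) x = subst (_~ x) (sym (succ^-suc k (pred (pred^ k x))))
    (~-trans (succ^-cong k (succ-pred (pred^ k x))) (succ^-pred^ k x))

  -- Going back along pred, two of the first n+1 vertices coincide
  -- (pigeonhole), so succ returns to the N-orbit of x after finitely many steps.
  period : ∀ x → Σ ℕ λ d → succ^ (suc d) x ~ x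
  period x with FP.pigeonhole (ℕP.n<1+n n) (λ i → pred^ (toℕ i) x)
  ... | i , j , i<j , same = d , ~-trans (succ^-cong (suc d) (~-sym back)) (succ^-pred^ (suc d) x)
    where
    a d : ℕ
    a = toℕ i
    d = toℕ j ∸ suc a
    j≡a+1+d : a + suc d ≡ toℕ j
    j≡a+1+d = trans (ℕP.+-suc a d) (ℕP.m+[n∸m]≡n {suc a} {toℕ j} i<j)
    back : pred^ (suc d) x ~ x
    back = ~-trans (~-sym (subst (λ z → succ^ a z ~ pred^ (suc d) x) pred^-j (succ^-pred^ a _)))
                   (subst (λ z → succ^ a z ~ x) same (succ^-pred^ a x))
      where
      pred^-j : pred^ a (pred^ (suc d) x) ≡ pred^ (toℕ j) x
      pred^-j = trans (sym (pred^-+ a (suc d) x)) (cong (λ m → pred^ m x) j≡a+1+d)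

  period-multiple : ∀ x p → succ^ p x ~ x → ∀ m → succ^ (m * p) x ~ x
  period-multiple x p _ zero = ~-refl x
  period-multiple x p back (suc m) = subst (_~ x) (sym (succ^-+ p (m * p) x))
    (~-trans (succ^-cong p (period-multiple x p back m)) back)

  -- succ is injective on N-orbits: y and z both return to their orbits
  -- after a common number m + 1 of steps, so applying succ^ m to
  -- succ y ~ succ z gives y ~ z.
  succ-injective : ∀ {y z} → succ y ~ succ z → y ~ z
  succ-injective {y} {z} e with period y | period z
  ... | d₁ , back₁ | d₂ , back₂ = ~-trans (~-sym y-back) (~-trans (subst₂ _~_ (sym (succ^-suc m y)) (sym (succ^-suc m z)) (succ^-cong m e)) z-back)
    where
    m : ℕ
    m = d₂ + d₁ * suc d₂
    y-back : succ^ (suc m) y ~ y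
    y-back = subst (λ q → succ^ q y ~ y) (ℕP.*-comm (suc d₂) (suc d₁)) (period-multiple y (suc d₁) back₁ (suc d₂))
    z-back : succ^ (suc m) z ~ z
    z-back = period-multiple z (suc d₂) back₂ (suc d₁)

  succ^-injective : ∀ k {y z} → succ^ k y ~ succ^ k z → y ~ z
  succ^-injective zero e = e
  succ^-injective (suc k) e = succ^-injective k (succ-injective e)

-- With Γ connected, the N-orbits form a single succ-cycle of some length
-- l, labelled by 0, …, l-1; G acts on the labels by translation.  If
-- l = 1 then N is transitive on vertices and edges, and otherwise the
-- translation amount is a homomorphism G → ℤ_l onto, with kernel the
-- kernel of the action of G on the N-orbits.
module CyclicQuotient {n : ℕ} {adj : Adj n} {G : PermGroup n} {r : ℕ}
  (R : RegularOrientation adj G r) (r>0 : 0 < r) {N : PermGroup n} (normal : NormalSub N G)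
  (local-transitive : ∀ {x y z} → RegularOrientation._⇒_ R x y → RegularOrientation._⇒_ R x z →
    Σ (Perm n) λ h → h ∈ elems (stab N x) × app h y ≡ z)
  (conn : Connected adj) (vt : VertexTransitive G) (α : Fin n) where

  open SuccessorOnOrbits R r>0 {N = N} normal local-transitive

  private
    Returns : ℕ → Set
    Returns j = succ^ (suc j) α ~ α

  -- The least period of the N-orbit of α under succ is l = k₀ + 1 (abstract
  -- for the same reason as succ).
  abstract
    least-period : Σ ℕ λ k → Returns k × (∀ j → j < k → ¬ Returns j)
    least-period = least (λ j → InOrbit? N (succ^ (suc j) α) α) (proj₁ (period α)) (proj₂ (period α))

  k₀ : ℕ
  k₀ = proj₁ least-period

  l : ℕ
  l = suc k₀

  returns : succ^ l α ~ α
  returns = proj₁ (proj₂ least-period)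

  no-earlier-return : ∀ e → 0 < e → e < l → ¬ succ^ e α ~ α
  no-earlier-return (suc j) _ (s≤s j<k₀) = proj₂ (proj₂ least-period) j j<k₀

  cycle-distinct : ∀ {a b} → a < b → b < l → ¬ succ^ a α ~ succ^ b α
  cycle-distinct {a} {b} a<b b<l e = no-earlier-return (suc d) (s≤s z≤n) d<l
    (~-sym (succ^-injective a (subst (succ^ a α ~_) b≡ e)))
    where
    d : ℕ
    d = b ∸ suc a
    a+1+d : a + suc d ≡ b
    a+1+d = trans (ℕP.+-suc a d) (ℕP.m+[n∸m]≡n {suc a} {b} a<b)
    d<l : suc d < l
    d<l = ℕP.≤-<-trans (subst (suc d ≤_) a+1+d (ℕP.m≤n+m _ a)) b<l
    b≡ : succ^ b α ≡ succ^ a (succ^ (suc d) α)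
    b≡ = trans (cong (λ q → succ^ q α) (sym a+1+d)) (succ^-+ a (suc d) α)

  cycle-injective : ∀ a b → a < l → b < l → succ^ a α ~ succ^ b α → a ≡ b
  cycle-injective a b a<l b<l e with ℕP.<-cmp a b
  ... | tri≈ _ a≡b _ = a≡b
  ... | tri< a<b _ _ = ⊥-elim (cycle-distinct a<b b<l e)
  ... | tri> _ _ b<a = ⊥-elim (cycle-distinct b<a a<l (~-sym e))

  succ^-mod : ∀ k → succ^ (k % l) α ~ succ^ k α
  succ^-mod k = subst (λ q → succ^ (k % l) α ~ succ^ q α) (sym (m≡m%n+[m/n]*n k l))
    (subst (succ^ (k % l) α ~_) (sym (succ^-+ (k % l) ((k / l) * l) α))
      (succ^-cong (k % l) (~-sym (period-multiple α l returns (k / l)))))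

  -- Every vertex is reached from α: crossing an edge forwards costs one
  -- step of succ, crossing it backwards costs l - 1 = k₀ steps.
  Reached : Fin n → Set
  Reached v = Σ ℕ λ k → succ^ k α ~ v

  reached-step : ∀ {x y} → Reached x → T (adj x y) → Reached y
  reached-step {x} {y} (k , αk~x) x—y with oriented x—y
  ... | inj₁ x⇒y = suc k , ~-trans (succ-cong αk~x) (succ-spec x⇒y)
  ... | inj₂ y⇒x = k + k₀ , succ-injective (subst (_~ succ y) (cong (λ q → succ^ q α) (ℕP.+-suc k k₀))
      (~-trans (back k) (~-trans αk~x (~-sym (succ-spec y⇒x)))))
    where
    back : ∀ a → succ^ (a + l) α ~ succ^ a α
    back a = subst (_~ succ^ a α) (sym (succ^-+ a l α)) (succ^-cong a returns)

  reached-path : ∀ {x y} → Reached x → Path adj x y → Reached y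
  reached-path rx here = rx
  reached-path rx (step x—w p) = reached-path (reached-step rx x—w) p

  abstract
    reached : ∀ v → Reached v
    reached v = reached-path (0 , ~-refl α) (conn α v)

  label : Fin n → Fin l
  label v = proj₁ (reached v) mod l

  label-spec : ∀ v → succ^ (toℕ (label v)) α ~ v
  label-spec v = subst (λ q → succ^ q α ~ v) (sym (FP.toℕ-fromℕ< (m%n<n (proj₁ (reached v)) l)))
    (~-trans (succ^-mod (proj₁ (reached v))) (proj₂ (reached v)))

  label-unique : ∀ v (i : Fin l) → succ^ (toℕ i) α ~ v → label v ≡ i
  label-unique v i αi~v = FP.toℕ-injective
    (cycle-injective _ _ (FP.toℕ<n (label v)) (FP.toℕ<n i) (~-trans (label-spec v) (~-sym αi~v)))

  label-labelling : OrbitLabelling N label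
  label-labelling = (λ i → succ^ (toℕ i) α , label-unique _ i (~-refl _))
    , (λ u v same → find (~-trans (~-sym (label-spec u)) (subst (λ i → succ^ (toℕ i) α ~ v) (sym same) (label-spec v))))
    , λ u v h h∈ hu≡v → sym (label-unique v (label u) (~-trans (label-spec u) (subst (u ~_) hu≡v (in-orbit N h∈))))

  -- g ∈ G translates labels by φ g, the label of g α.
  φ : Perm n → Fin l
  φ g = label (app g α)

  toℕ-addMod : ∀ (x y : Fin l) → toℕ (addMod x y) ≡ (toℕ x + toℕ y) % l
  toℕ-addMod x y = FP.toℕ-fromℕ< (m%n<n (toℕ x + toℕ y) l)

  translation : ∀ {g} → g ∈ elems G → ∀ v → label (app g v) ≡ addMod (label v) (φ g)
  translation {g} g∈ v = label-unique (app g v) (addMod (label v) (φ g))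
    (subst (λ q → succ^ q α ~ app g v) (sym (toℕ-addMod (label v) (φ g))) (begin
      succ^ ((b + a) % l) α      ∼⟨ succ^-mod (b + a) ⟩
      succ^ (b + a) α            ≡⟨ succ^-+ b a α ⟩
      succ^ b (succ^ a α)        ∼⟨ succ^-cong b (label-spec (app g α)) ⟩
      succ^ b (app g α)          ∼⟨ ~-sym (succ^-equivariant b α g∈) ⟩
      app g (succ^ b α)          ∼⟨ ~-invariant g∈ (label-spec v) ⟩
      app g v                    ∎))
    where
    b a : ℕ
    b = toℕ (label v)
    a = toℕ (φ g)
    open ~-Reasoning

  φ-hom : ∀ {g h} → g ∈ elems G → h ∈ elems G → φ (g ∘ₚ h) ≡ addMod (φ g) (φ h)
  φ-hom {g} {h} g∈ h∈ = trans (cong label (app-∘ g h α))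
    (trans (translation g∈ (app h α)) (cong (_mod l) (ℕP.+-comm (toℕ (φ h)) (toℕ (φ g)))))

  φ-onto : ∀ (i : Fin l) → Σ (Perm n) λ g → g ∈ elems G × φ g ≡ i
  φ-onto i with vt α (succ^ (toℕ i) α)
  ... | g , g∈ , gα≡ = g , g∈ , trans (cong label gα≡) (label-unique _ i (~-refl _))

  φ-kernel : ∀ {g} → g ∈ elems G → (toℕ (φ g) ≡ 0 → InKernel label g) × (InKernel label g → toℕ (φ g) ≡ 0)
  φ-kernel {g} g∈ = (λ φg≡0 v → trans (translation g∈ v) (FP.toℕ-injective (begin
      toℕ (addMod (label v) (φ g))       ≡⟨ toℕ-addMod (label v) (φ g) ⟩
      (toℕ (label v) + toℕ (φ g)) % l    ≡⟨ cong (λ q → (toℕ (label v) + q) % l) φg≡0 ⟩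
      (toℕ (label v) + 0) % l            ≡⟨ cong (_% l) (ℕP.+-identityʳ (toℕ (label v))) ⟩
      toℕ (label v) % l                  ≡⟨ m<n⇒m%n≡m (FP.toℕ<n (label v)) ⟩
      toℕ (label v)                      ∎)))
    , λ fixes → cong toℕ (trans (fixes α) (label-unique α F.zero (~-refl α)))
    where open ≡-Reasoning

  -- A vertex-transitive N is transitive on the arcs of the orientation:
  -- first move the tail, then use local transitivity at it.
  N-arc-transitive : VertexTransitive N → ∀ {a b c d} → a ⇒ b → c ⇒ d →
    Σ (Perm n) λ h → h ∈ elems N × app h a ≡ c × app h b ≡ d
  N-arc-transitive vtN {a} {b} {c} a⇒b c⇒d with vtN a c
  ... | h₁ , h₁∈ , refl with local-transitive (invariant (N⊑G h₁∈) a⇒b) c⇒d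
  ...   | h₂ , h₂∈ , h₂-maps = h₂ ∘ₚ h₁ , closed N (stab⊆ N _ h₂∈) h₁∈
          , trans (app-∘ h₂ h₁ a) (stab-fixes N _ h₂∈) , trans (app-∘ h₂ h₁ b) h₂-maps

  -- Every edge is an arc in one direction, so N is then edge-transitive.
  edge-transitive : VertexTransitive N → EdgeTransitive adj N
  edge-transitive vtN u v x y u—v x—y with oriented u—v | oriented x—y
  ... | inj₁ u⇒v | inj₁ x⇒y = let (h , h∈ , hu , hv) = N-arc-transitive vtN u⇒v x⇒y in h , h∈ , inj₁ (hu , hv)
  ... | inj₁ u⇒v | inj₂ y⇒x = let (h , h∈ , hu , hv) = N-arc-transitive vtN u⇒v y⇒x in h , h∈ , inj₂ (hu , hv)
  ... | inj₂ v⇒u | inj₁ x⇒y = let (h , h∈ , hv , hu) = N-arc-transitive vtN v⇒u x⇒y in h , h∈ , inj₂ (hu , hv)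
  ... | inj₂ v⇒u | inj₂ y⇒x = let (h , h∈ , hv , hu) = N-arc-transitive vtN v⇒u y⇒x in h , h∈ , inj₁ (hu , hv)

  structure : (VertexTransitive N × EdgeTransitive adj N) ⊎ QuotientCyclic G N
  structure with k₀ ℕP.≟ 0
  ... | yes k₀≡0 = inj₁ (vtN , edge-transitive vtN)
    where
    one-label : ∀ (i j : Fin l) → i ≡ j
    one-label i j = FP.toℕ-injective (trans (zero-label i) (sym (zero-label j)))
      where
      zero-label : ∀ (i : Fin l) → toℕ i ≡ 0
      zero-label i = ℕP.n≤0⇒n≡0 (subst (toℕ i ≤_) k₀≡0 (ℕP.≤-pred (FP.toℕ<n i)))
    vtN : VertexTransitive N
    vtN u v = proj₁ (proj₂ label-labelling) u v (one-label (label u) (label v))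
  ... | no k₀≢0 = inj₂ (l , label , label-labelling , s≤s (ℕP.n≢0⇒n>0 k₀≢0) , φ , φ-hom , φ-onto , φ-kernel)

prime-positive : ∀ {p} → Prime p → 0 < p
prime-positive {p} p-prime = >-nonZero⁻¹ p {{prime⇒nonZero p-prime}}

-- The conclusion, given a regular orientation in which some k ∈ N fixes
-- u and moves the out-neighbour w of u: LocalAction gives r ∣ |N_α| and
-- local transitivity, fixer-primes bounds the primes dividing |N_α|, and
-- CyclicQuotient gives the two alternatives.
non-semiregular-case : ∀ {n} {adj : Adj n} {G : PermGroup n} {r : ℕ} (R : RegularOrientation adj G r) →
  Prime r → Connected adj → VertexTransitive G → (N : PermGroup n) → NormalSub N G → (α : Fin n) →
  ∀ {u w k} → k ∈ elems N → app k u ≡ u → RegularOrientation._⇒_ R u w → ¬ app k w ≡ w →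
  IsMaxPrimeDivisor r (stabOrder N α) × ((VertexTransitive N × EdgeTransitive adj N) ⊎ QuotientCyclic G N)
non-semiregular-case {r = r} R r-prime conn vt N normal α k∈N k-fixes u⇒w k-moves =
  (r-prime , r-divides-stab (⇒succ α) , primes-bounded) , structure
  where
  r>0 : 0 < r
  r>0 = prime-positive r-prime
  open LocalAction R r-prime {N = N} normal k∈N k-fixes u⇒w k-moves
  open CyclicQuotient R r>0 {N = N} normal local-transitive conn vt α
  open SuccessorOnOrbits R r>0 {N = N} normal local-transitive using (⇒succ)
  primes-bounded : ∀ p → Prime p → p ∣ stabOrder N α → p ≤ r
  primes-bounded = fixer-primes R conn (stab N α) (λ m → proj₁ normal (stab⊆ N α m)) α (All.tabulate (stab-fixes N α))

-- If some non-identity k ∈ N fixes a vertex then, by connectivity, k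
-- fixes a vertex u and moves a neighbour w; orient the edge {u, w} away
-- from u, reversing R if necessary.
fixer-case : ∀ {n} {adj : Adj n} {G : PermGroup n} {r : ℕ} (R : RegularOrientation adj G r) →
  Prime r → Connected adj → VertexTransitive G → (N : PermGroup n) → NormalSub N G → (α : Fin n) →
  ∀ {k v} → k ∈ elems N → app k v ≡ v → ¬ k ≡ idP →
  IsMaxPrimeDivisor r (stabOrder N α) × ((VertexTransitive N × EdgeTransitive adj N) ⊎ QuotientCyclic G N)
fixer-case {adj = adj} R r-prime conn vt N normal α k∈N kv≡v k≢id
  with fixed-moved-edge adj conn kv≡v k≢id
... | u , w , u—w , ku≡u , kw≢w with RegularOrientation.oriented R u—w
...   | inj₁ u⇒w = non-semiregular-case R r-prime conn vt N normal α k∈N ku≡u u⇒w kw≢w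
...   | inj₂ w⇒u = non-semiregular-case (reverse R) r-prime conn vt N normal α k∈N ku≡u w⇒u kw≢w

lemma3p3 : ∀ {n} (adj : Adj n) (r : ℕ) → Prime r →
  SimpleGraph adj → Connected adj → (∀ v → degree adj v ≡ 2 * r) →
  (G : PermGroup n) → AutGroup adj G →
  VertexTransitive G → EdgeTransitive adj G → ¬ TwoArcTransitive adj G →
  ¬ ArcTransitive adj G →
  (N : PermGroup n) → NormalSub N G → Nontrivial N → (α : Fin n) →
  Semiregular N ⊎
    (IsMaxPrimeDivisor r (stabOrder N α) ×
      ((VertexTransitive N × EdgeTransitive adj N) ⊎ QuotientCyclic G N))
lemma3p3 adj r r-prime simple conn valency G aut vt et _ ¬at N normal _ α with semiregular-or-fixer N
... | inj₁ semiregular = inj₁ semiregular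
... | inj₂ (k , v , k∈N , kv≡v , k≢id) = inj₂ (fixer-case R r-prime conn vt N normal α k∈N kv≡v k≢id)
  where
  R : RegularOrientation adj G r
  R = half-arc-orientation adj r (prime-positive r-prime) simple valency G aut vt et ¬at α
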